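{- Let $r\ge 3$ and let $M$ be the binary matroid $P_r\backslash P_{r-i}$ for some $i\in\{1,2,\dots,r-1\}$. Then $M$ has a flat $F$ such that $M|F$ is isomorphic to $M(K_4)$ or to $U_{3,4}$.
   Context: $P_k$ denotes the binary projective geometry $PG(k-1,2)$. $P_r\backslash P_{r-i}$ denotes the matroid obtained from $P_r$ by deleting the elements of a rank-$(r-i)$ flat (independent of the choice of flat). -}

module Defs where

open import Data.Nat using (ℕ; zero; suc; _<_; _≤_)
open import Data.Bool using (Bool; true; false; _xor_; if_then_else_)
open import Data.Fin using (Fin; zero; suc; toℕ; inject₁; fromℕ)
open import Data.Fin.Subset using (Subset; ∣_∣)
open import Data.Vec using (Vec; []; _∷_; lookup; replicate; zipWith; tabulate)
open import Data.List using (List; []; _∷_; length; foldr)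
open import Data.List.Membership.Propositional using (_∈_; _∉_)
open import Data.List.Relation.Binary.Sublist.Propositional using (_⊆_)
open import Data.List.Relation.Unary.All using (All)
open import Data.List.Relation.Unary.Unique.Propositional using (Unique)
open import Data.Product using (Σ; _×_; _,_)
open import Data.Sum using (_⊎_)
open import Relation.Nullary using (¬_)
open import Relation.Binary.PropositionalEquality using (_≡_)
open import Function.Definitions using (Injective; Bijective)
open import Function.Bundles using (_⇔_)

V : ℕ → Set
V r = Vec Bool r

0V : ∀ {r} → V r
0V {r} = replicate r false

_⊕_ : ∀ {r} → V r → V r → V r
_⊕_ = zipWith _xor_

vsum : ∀ {r} → List (V r) → V r
vsum = foldr _⊕_ 0V

-- A list of vectors is linearly independent over GF(2):
-- no nonempty sublist sums to zero (in particular no repeats).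
LinIndep : ∀ {r} → List (V r) → Set
LinIndep xs = ∀ ys → ys ⊆ xs → vsum ys ≡ 0V → ys ≡ []

record FinMatroid : Set₁ where
  field
    size  : ℕ
    Indep : Subset size → Set
open FinMatroid public

pull : ∀ {m n} → (Fin m → Fin n) → Subset n → Subset m
pull σ S = tabulate (λ j → lookup S (σ j))

_≅_ : FinMatroid → FinMatroid → Set
M ≅ N = Σ (Fin (size M) → Fin (size N)) λ σ →
          Bijective _≡_ _≡_ σ × (∀ S → Indep N S ⇔ Indep M (pull σ S))

select : ∀ {A : Set} (xs : List A) → Subset (length xs) → List A
select [] [] = []
select (x ∷ xs) (b ∷ s) = if b then x ∷ select xs s else select xs s

-- vector matroid of a list of vectors (used for the restriction M|F)
vecMatroid : ∀ {r} → List (V r) → FinMatroid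
vecMatroid F = record { size = length F ; Indep = λ S → LinIndep (select F S) }

-- The matroid M = P_r \ P_{r-i}: ground set = nonzero vectors of GF(2)^r
-- not in the rank-(r-i) flat {v | v_j = 0 for all j < i}.

InM : ∀ {r} → ℕ → V r → Set
InM {r} i v = Σ (Fin r) λ j → (toℕ j < i) × (lookup v j ≡ true)

-- F (a duplicate-free list of elements of M) is a flat of M:
-- every element of M outside F extends every independent subset of F
-- to an independent set (i.e. lies outside the closure of F).
IsFlat : ∀ {r} → ℕ → List (V r) → Set
IsFlat {r} i F =
  Unique F × All (InM i) F ×
  (∀ (e : V r) → InM i e → e ∉ F →
     ∀ X → X ⊆ F → LinIndep X → LinIndep (e ∷ X))

endsK4 : Fin 6 → Fin 4 × Fin 4
endsK4 zero = (zero , suc zero)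
endsK4 (suc zero) = (zero , suc (suc zero))
endsK4 (suc (suc zero)) = (zero , suc (suc (suc zero)))
endsK4 (suc (suc (suc zero))) = (suc zero , suc (suc zero))
endsK4 (suc (suc (suc (suc zero)))) = (suc zero , suc (suc (suc zero)))
endsK4 (suc (suc (suc (suc (suc zero))))) = (suc (suc zero) , suc (suc (suc zero)))

Joins : Fin 6 → Fin 4 → Fin 4 → Set
Joins e a b = (endsK4 e ≡ (a , b)) ⊎ (endsK4 e ≡ (b , a))

HasCycle : Subset 6 → Set
HasCycle S = Σ ℕ λ m →
  Σ (Fin (suc (suc (suc m))) → Fin 4) λ v →
  Σ (Fin (suc (suc m)) → Fin 6) λ p →
  Σ (Fin 6) λ c →
    Injective _≡_ _≡_ v ×
    (∀ j → lookup S (p j) ≡ true) ×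
    (∀ j → Joins (p j) (v (inject₁ j)) (v (suc j))) ×
    lookup S c ≡ true ×
    Joins c (v (fromℕ (suc (suc m)))) (v zero)

MK4 : FinMatroid
MK4 = record { size = 6 ; Indep = λ S → ¬ HasCycle S }

U34 : FinMatroid
U34 = record { size = 4 ; Indep = λ S → ∣ S ∣ ≤ 3 }

{-# OPTIONS --safe #-}
-- Let W be the plane of GF(2)^r spanned by e₀, e₁ and the last unit vector e_{r-1}; the
-- deleted flat is {v | v_j = 0 for j < i}.  Since W is a subspace, W ∩ M is a flat of M: an
-- element of M spanned by W ∩ M lies in W, hence in W ∩ M.  If i = 1 the deleted flat meets W
-- in the line v₀ = 0, leaving the affine plane AG(2,2) ≅ U_{3,4}; if i ≥ 2 it meets W only in
-- e_{r-1}, leaving PG(2,2) minus a point ≅ M(K₄).  Both identifications are finite checks in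
-- GF(2)³, where (for the right labelling of the edges) a set of edges of K₄ contains a cycle
-- exactly when the corresponding vectors are dependent.

module Submission where

open import Defs
open import Data.Nat using (ℕ; zero; suc; _+_; _≤_; _<_; z≤n; s≤s; _≤?_)
open import Data.Nat.Properties using (≤-trans; <-irrefl; 1+n≢n)
open import Data.Bool using (Bool; true; false; _xor_)
import Data.Bool.Properties as Bool
open import Data.Fin using (Fin; zero; suc; toℕ; inject₁; fromℕ)
open import Data.Fin.Properties using (any?; all?; toℕ-inject₁; <⇒notInjective) renaming (_≟_ to _≟ᶠ_)
open import Data.Fin.Subset using (Subset; ∣_∣)
open import Data.Fin.Subset.Properties using (anySubset?)
open import Data.Vec using (Vec; []; _∷_; lookup; tabulate; cast)
open import Data.Vec.Properties
  using (zipWith-assoc; zipWith-identityˡ; zipWith-identityʳ; lookup∘tabulate; tabulate∘lookup; cast-is-id)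
import Data.Vec.Properties as Vec
open import Data.List using (List; []; _∷_; map; length)
open import Data.List.Properties using (length-map)
open import Data.List.Relation.Binary.Sublist.Propositional using (_⊆_; []; _∷_; _∷ʳ_; ⊆-trans)
import Data.List.Relation.Binary.Sublist.Propositional.Properties as Sublist
open import Data.List.Relation.Unary.All using (All; []; _∷_)
import Data.List.Relation.Unary.All.Properties as All
open import Data.List.Relation.Unary.Any using (here; there)
open import Data.List.Membership.Propositional using (_∈_; _∉_)
open import Data.List.Membership.Propositional.Properties using (∈-map⁺)
open import Data.List.Relation.Unary.Unique.Propositional using (Unique)
import Data.List.Relation.Unary.Unique.Propositional.Properties as Unique
import Data.List.Relation.Unary.Unique.DecPropositional
open import Data.Product using (Σ; ∃; ∃₂; _×_; _,_)
open import Data.Product.Properties using (≡-dec)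
open import Data.Sum using (_⊎_; inj₁; inj₂)
open import Data.Empty using (⊥-elim)
open import Data.Unit using (tt)
open import Function using (_∘_; id; const)
open import Function.Bundles using (_⇔_; mk⇔; Equivalence)
open import Function.Construct.Composition using (_⇔-∘_)
open import Function.Construct.Symmetry using (⇔-sym)
open import Function.Construct.Identity using (bijective)
open import Function.Definitions using (Injective)
open import Relation.Nullary using (¬_; Dec; yes; no; does; ¬?; _×-dec_; _⊎-dec_; _→-dec_)
open import Relation.Nullary.Decidable using (True; from-yes; toWitness; decidable-stable)
import Relation.Nullary.Decidable as Dec
open import Relation.Unary using (Decidable)
open import Relation.Binary.Definitions using (DecidableEquality)
open import Relation.Binary.PropositionalEquality
  using (_≡_; _≢_; refl; sym; trans; cong; cong₂; subst; subst₂; module ≡-Reasoning)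

allSubset? : ∀ {n} {P : Subset n → Set} → Decidable P → Dec (∀ S → P S)
allSubset? P? = Dec.map
  (mk⇔ (λ ¬∃¬ S → decidable-stable (P? S) (λ ¬p → ¬∃¬ (S , ¬p)))
       (λ ∀P (S , ¬p) → ¬p (∀P S)))
  (¬? (anySubset? (¬? ∘ P?)))

anyVec? : ∀ {n k} {P : Vec (Fin k) n → Set} → Decidable P → Dec (∃ P)
anyVec? {zero}  P? = Dec.map (mk⇔ ([] ,_) λ { ([] , p) → p }) (P? [])
anyVec? {suc n} P? = Dec.map
  (mk⇔ (λ (a , vs , p) → a ∷ vs , p) λ { (a ∷ vs , p) → a , vs , p })
  (any? λ a → anyVec? (P? ∘ (a ∷_)))

injective? : ∀ {m n} (f : Fin m → Fin n) → Dec (Injective _≡_ _≡_ f)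
injective? f = Dec.map (mk⇔ (λ h {x} {y} → h x y) (λ h _ _ → h))
  (all? λ x → all? λ y → f x ≟ᶠ f y →-dec x ≟ᶠ y)

does-≡⇒⇔ : ∀ {A B : Set} (a? : Dec A) (b? : Dec B) → does a? ≡ does b? → A ⇔ B
does-≡⇒⇔ (yes a) (yes b) _  = mk⇔ (const b) (const a)
does-≡⇒⇔ (no ¬a) (no ¬b) _  = mk⇔ (⊥-elim ∘ ¬a) (⊥-elim ∘ ¬b)
does-≡⇒⇔ (yes _) (no _)  ()
does-≡⇒⇔ (no _)  (yes _) ()

⇔-onAllSubsets : ∀ {n} {P Q : Subset n → Set} (P? : Decidable P) (Q? : Decidable Q) →
  True (allSubset? λ S → does (P? S) Bool.≟ does (Q? S)) → ∀ S → P S ⇔ Q S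
⇔-onAllSubsets P? Q? agree S = does-≡⇒⇔ (P? S) (Q? S) (toWitness agree S)

⊕-assoc : ∀ {n} (x y z : V n) → (x ⊕ y) ⊕ z ≡ x ⊕ (y ⊕ z)
⊕-assoc = zipWith-assoc Bool.xor-assoc

⊕-identityˡ : ∀ {n} (x : V n) → 0V ⊕ x ≡ x
⊕-identityˡ = zipWith-identityˡ Bool.xor-identityˡ

⊕-identityʳ : ∀ {n} (x : V n) → x ⊕ 0V ≡ x
⊕-identityʳ = zipWith-identityʳ Bool.xor-identityʳ

⊕-self : ∀ {n} (x : V n) → x ⊕ x ≡ 0V
⊕-self []      = refl
⊕-self (a ∷ x) = cong₂ _∷_ (Bool.xor-same a) (⊕-self x)

⊕-cancelˡ : ∀ {n} (x y : V n) → x ⊕ (x ⊕ y) ≡ y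
⊕-cancelˡ x y = begin
  x ⊕ (x ⊕ y)  ≡⟨ sym (⊕-assoc x x y) ⟩
  (x ⊕ x) ⊕ y  ≡⟨ cong (_⊕ y) (⊕-self x) ⟩
  0V ⊕ y       ≡⟨ ⊕-identityˡ y ⟩
  y            ∎
  where open ≡-Reasoning

⊕≡0V⇒≡ : ∀ {n} {x y : V n} → x ⊕ y ≡ 0V → x ≡ y
⊕≡0V⇒≡ {x = x} {y} x⊕y≡0 = begin
  x                ≡⟨ sym (⊕-identityʳ x) ⟩
  x ⊕ 0V           ≡⟨ cong (x ⊕_) (sym x⊕y≡0) ⟩
  x ⊕ (x ⊕ y)      ≡⟨ ⊕-cancelˡ x y ⟩
  y                ∎
  where open ≡-Reasoning

InSpan : ∀ {n} → List (V n) → V n → Set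
InSpan xs v = ∃ λ ys → ys ⊆ xs × vsum ys ≡ v

inSpan? : ∀ {n} (xs : List (V n)) (v : V n) → Dec (InSpan xs v)
inSpan? []       v = Dec.map (mk⇔ (λ 0≡v → [] , [] , 0≡v) λ { ([] , [] , e) → e })
                             (Vec.≡-dec Bool._≟_ 0V v)
inSpan? (x ∷ xs) v = Dec.map (mk⇔ to from) (inSpan? xs v ⊎-dec inSpan? xs (x ⊕ v))
  where
  to : InSpan xs v ⊎ InSpan xs (x ⊕ v) → InSpan (x ∷ xs) v
  to (inj₁ (ys , ys⊆ , e)) = ys , x ∷ʳ ys⊆ , e
  to (inj₂ (ys , ys⊆ , e)) = x ∷ ys , refl ∷ ys⊆ , trans (cong (x ⊕_) e) (⊕-cancelˡ x v)
  from : InSpan (x ∷ xs) v → InSpan xs v ⊎ InSpan xs (x ⊕ v)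
  from (ys     , _ ∷ʳ ys⊆   , e) = inj₁ (ys , ys⊆ , e)
  from (_ ∷ ys , refl ∷ ys⊆ , e) =
    inj₂ (ys , ys⊆ , trans (sym (⊕-cancelˡ x (vsum ys))) (cong (x ⊕_) e))

linIndep-[] : ∀ {n} → LinIndep {n} []
linIndep-[] .[] [] _ = refl

linIndep-∷⇔ : ∀ {n} {x : V n} {xs} → (LinIndep xs × ¬ InSpan xs x) ⇔ LinIndep (x ∷ xs)
linIndep-∷⇔ {x = x} {xs} = mk⇔ to from
  where
  to : LinIndep xs × ¬ InSpan xs x → LinIndep (x ∷ xs)
  to (li , _)   ys (_ ∷ʳ ys⊆)   e = li ys ys⊆ e
  to (_  , x∉) (_ ∷ ys) (refl ∷ ys⊆) e = ⊥-elim (x∉ (ys , ys⊆ , sym (⊕≡0V⇒≡ e)))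
  from : LinIndep (x ∷ xs) → LinIndep xs × ¬ InSpan xs x
  from li = (λ ys ys⊆ → li ys (x ∷ʳ ys⊆))
          , λ (ys , ys⊆ , e) → ∷≢[] (li (x ∷ ys) (refl ∷ ys⊆) (trans (cong (x ⊕_) e) (⊕-self x)))
    where
    ∷≢[] : ∀ {ys : List (V _)} → x ∷ ys ≢ []
    ∷≢[] ()

linIndep? : ∀ {n} (xs : List (V n)) → Dec (LinIndep xs)
linIndep? []       = yes linIndep-[]
linIndep? (x ∷ xs) = Dec.map linIndep-∷⇔ (linIndep? xs ×-dec ¬? (inSpan? xs x))

⊆-map⁻ : ∀ {A B : Set} (f : A → B) {xs zs} → zs ⊆ map f xs → ∃ λ ys → ys ⊆ xs × zs ≡ map f ys
⊆-map⁻ f {[]}     []          = [] , [] , refl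
⊆-map⁻ f {x ∷ xs} (_ ∷ʳ zs⊆)  with ⊆-map⁻ f zs⊆
... | ys , ys⊆ , refl = ys , x ∷ʳ ys⊆ , refl
⊆-map⁻ f {x ∷ xs} (refl ∷ zs⊆) with ⊆-map⁻ f zs⊆
... | ys , ys⊆ , refl = x ∷ ys , refl ∷ ys⊆ , refl

select-map : ∀ {A B : Set} (f : A → B) xs (S : Subset (length (map f xs))) →
  select (map f xs) S ≡ map f (select xs (cast (length-map f xs) S))
select-map f []       []          = refl
select-map f (x ∷ xs) (true ∷ S)  = cong (f x ∷_) (select-map f xs S)
select-map f (x ∷ xs) (false ∷ S) = select-map f xs S

module LinearEmbedding {m n} (f : V m → V n)
  (f-⊕ : ∀ x y → f (x ⊕ y) ≡ f x ⊕ f y) (f-injective : Injective _≡_ _≡_ f) where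

  f-0V : f 0V ≡ 0V
  f-0V = begin
    f 0V            ≡⟨ cong f (sym (⊕-self 0V)) ⟩
    f (0V ⊕ 0V)     ≡⟨ f-⊕ 0V 0V ⟩
    f 0V ⊕ f 0V     ≡⟨ ⊕-self (f 0V) ⟩
    0V              ∎
    where open ≡-Reasoning

  vsum-map : ∀ xs → vsum (map f xs) ≡ f (vsum xs)
  vsum-map []       = sym f-0V
  vsum-map (x ∷ xs) = trans (cong (f x ⊕_) (vsum-map xs)) (sym (f-⊕ x (vsum xs)))

  linIndep-map : ∀ {xs} → LinIndep (map f xs) ⇔ LinIndep xs
  linIndep-map {xs} = mk⇔ to from
    where
    map≡[] : ∀ {ys} → map f ys ≡ [] → ys ≡ []
    map≡[] {[]} _ = refl
    to : LinIndep (map f xs) → LinIndep xs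
    to li ys ys⊆ e = map≡[] (li (map f ys) (Sublist.map⁺ f ys⊆)
                              (trans (vsum-map ys) (trans (cong f e) f-0V)))
    from : LinIndep xs → LinIndep (map f xs)
    from li zs zs⊆ e with ⊆-map⁻ f zs⊆
    ... | ys , ys⊆ , refl =
      cong (map f) (li ys ys⊆ (f-injective (trans (sym (vsum-map ys)) (trans e (sym f-0V)))))

  linIndep-select-map : ∀ xs S →
    LinIndep (select (map f xs) S) ⇔ LinIndep (select xs (cast (length-map f xs) S))
  linIndep-select-map xs S =
    subst (λ ys → LinIndep ys ⇔ LinIndep (select xs (cast (length-map f xs) S)))
          (sym (select-map f xs S)) linIndep-map

  isFlat-map : ∀ {i} xs → Unique xs → All (InM i ∘ f) xs → (∀ t → InM i (f t) → t ∈ xs) →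
    IsFlat i (map f xs)
  isFlat-map {i} xs unique inM complete = Unique.map⁺ f-injective unique , All.map⁺ inM , extend
    where
    span⊆image : ∀ {X e} → X ⊆ map f xs → InSpan X e → ∃ λ t → e ≡ f t
    span⊆image X⊆ (zs , zs⊆ , refl) with ⊆-map⁻ f (⊆-trans zs⊆ X⊆)
    ... | ys , _ , refl = vsum ys , vsum-map ys
    extend : ∀ e → InM i e → e ∉ map f xs → ∀ X → X ⊆ map f xs → LinIndep X → LinIndep (e ∷ X)
    extend e e∈M e∉ X X⊆ liX = Equivalence.to linIndep-∷⇔ (liX , e∉span)
      where
      e∉span : ¬ InSpan X e
      e∉span e∈span with span⊆image X⊆ e∈span
      ... | t , refl = e∉ (∈-map⁺ f (complete t e∈M))

joins? : ∀ e a b → Dec (Joins e a b)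
joins? e a b = endsK4 e ≟ₑ (a , b) ⊎-dec endsK4 e ≟ₑ (b , a)
  where
  _≟ₑ_ : DecidableEquality (Fin 4 × Fin 4)
  _≟ₑ_ = ≡-dec _≟ᶠ_ _≟ᶠ_

-- edge a a is a junk value.
edge : Fin 4 → Fin 4 → Fin 6
edge a b with any? (λ e → joins? e a b)
... | yes (e , _) = e
... | no _        = zero

edge-joins : ∀ {a b} → a ≢ b → Joins (edge a b) a b
edge-joins {a} {b} =
  from-yes (all? λ a → all? λ b → ¬? (a ≟ᶠ b) →-dec joins? (edge a b) a b) a b

joins⇒≡edge : ∀ {e a b} → Joins e a b → e ≡ edge a b
joins⇒≡edge {e} {a} {b} =
  from-yes (all? λ e → all? λ a → all? λ b → joins? e a b →-dec e ≟ᶠ edge a b) e a b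

EdgeIn : Subset 6 → Fin 4 → Fin 4 → Set
EdgeIn S a b = lookup S (edge a b) ≡ true

Cycle : Subset 6 → ∀ {m} → (Fin (3 + m) → Fin 4) → Set
Cycle S {m} v = Injective _≡_ _≡_ v
  × (∀ j → EdgeIn S (v (inject₁ j)) (v (suc j)))
  × EdgeIn S (v (fromℕ (2 + m))) (v zero)

cycle? : ∀ S {m} (v : Fin (3 + m) → Fin 4) → Dec (Cycle S v)
cycle? S v = injective? v ×-dec all? (λ j → lookup S _ Bool.≟ true) ×-dec lookup S _ Bool.≟ true

cycle-resp-≗ : ∀ {S m} {v w : Fin (3 + m) → Fin 4} → (∀ x → v x ≡ w x) → Cycle S v → Cycle S w
cycle-resp-≗ {S} v≗w (inj , path , closing) =
    (λ {x} {y} e → inj (trans (v≗w x) (trans e (sym (v≗w y)))))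
  , (λ j → subst₂ (EdgeIn S) (v≗w _) (v≗w _) (path j))
  , subst₂ (EdgeIn S) (v≗w _) (v≗w _) closing

hasCycle⇔cycle : ∀ {S} → HasCycle S ⇔ ∃₂ λ m (v : Fin (3 + m) → Fin 4) → Cycle S v
hasCycle⇔cycle {S} = mk⇔ to from
  where
  onEdge : ∀ {e a b} → lookup S e ≡ true → Joins e a b → EdgeIn S a b
  onEdge e∈S j = subst (λ e → lookup S e ≡ true) (joins⇒≡edge j) e∈S
  to : HasCycle S → ∃₂ λ m (v : Fin (3 + m) → Fin 4) → Cycle S v
  to (m , v , _ , _ , inj , p∈S , pJoins , c∈S , cJoins) =
    m , v , inj , (λ j → onEdge (p∈S j) (pJoins j)) , onEdge c∈S cJoins
  from : (∃₂ λ m (v : Fin (3 + m) → Fin 4) → Cycle S v) → HasCycle S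
  from (m , v , inj , path , closing) =
      m , v , (λ j → edge (v (inject₁ j)) (v (suc j))) , edge (v (fromℕ (2 + m))) (v zero)
    , inj , path
    , (λ j → edge-joins λ e → 1+n≢n (sym (trans (sym (toℕ-inject₁ j)) (cong toℕ (inj e)))))
    , closing , edge-joins λ e → fromℕ≢zero (inj e)
    where
    fromℕ≢zero : fromℕ (2 + m) ≢ zero
    fromℕ≢zero ()

hasCycle? : ∀ S → Dec (HasCycle S)
hasCycle? S = Dec.map (⇔-sym (hasCycle⇔cycle {S}) ⇔-∘ mk⇔ to from)
  (anyVec? (cycle? S ∘ lookup) ⊎-dec anyVec? (cycle? S ∘ lookup))
  where
  Short : Set
  Short = (∃ λ (vs : Vec (Fin 4) 3) → Cycle S (lookup vs))
        ⊎ (∃ λ (vs : Vec (Fin 4) 4) → Cycle S (lookup vs))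
  to : Short → ∃₂ λ m (v : Fin (3 + m) → Fin 4) → Cycle S v
  to (inj₁ (vs , c)) = 0 , lookup vs , c
  to (inj₂ (vs , c)) = 1 , lookup vs , c
  tabulated : ∀ {m} {v : Fin (3 + m) → Fin 4} → Cycle S v → Cycle S (lookup (tabulate v))
  tabulated = cycle-resp-≗ {S} (sym ∘ lookup∘tabulate _)
  from : (∃₂ λ m (v : Fin (3 + m) → Fin 4) → Cycle S v) → Short
  from (0 , v , c)     = inj₁ (tabulate v , tabulated c)
  from (1 , v , c)     = inj₂ (tabulate v , tabulated c)
  from (suc (suc m) , v , inj , _) =
    ⊥-elim (<⇒notInjective (s≤s (s≤s (s≤s (s≤s (s≤s z≤n))))) inj)

onlyLast : ∀ k → Bool → V (suc k)
onlyLast zero    c = c ∷ []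
onlyLast (suc k) c = false ∷ onlyLast k c

onlyLast-⊕ : ∀ k c d → onlyLast k (c xor d) ≡ onlyLast k c ⊕ onlyLast k d
onlyLast-⊕ zero    c d = refl
onlyLast-⊕ (suc k) c d = cong (false ∷_) (onlyLast-⊕ k c d)

onlyLast-injective : ∀ k → Injective _≡_ _≡_ (onlyLast k)
onlyLast-injective zero    refl = refl
onlyLast-injective (suc k) e    = onlyLast-injective k (Vec.∷-injectiveʳ e)

lookup-onlyLast : ∀ k {c} (j : Fin (suc k)) → lookup (onlyLast k c) j ≡ true → toℕ j ≡ k
lookup-onlyLast zero    zero    _ = refl
lookup-onlyLast (suc k) (suc j) e = cong suc (lookup-onlyLast k j e)

plane : ∀ k → V 3 → V (3 + k)
plane k (a ∷ b ∷ c ∷ []) = a ∷ b ∷ onlyLast k c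

plane-⊕ : ∀ k x y → plane k (x ⊕ y) ≡ plane k x ⊕ plane k y
plane-⊕ k (a ∷ b ∷ c ∷ []) (a′ ∷ b′ ∷ c′ ∷ []) =
  cong (λ w → (a xor a′) ∷ (b xor b′) ∷ w) (onlyLast-⊕ k c c′)

plane-injective : ∀ k → Injective _≡_ _≡_ (plane k)
plane-injective k {a ∷ b ∷ c ∷ []} {_ ∷ _ ∷ c′ ∷ []} e with Vec.∷-injective e
... | refl , e′ with Vec.∷-injective e′
... | refl , e″ = cong (λ c → a ∷ b ∷ c ∷ []) (onlyLast-injective k e″)

-- The j-th vector is p_a ⊕ p_b for the j-th edge ab of endsK4, where p₀ = 0, p₁ = e₀, p₂ = e₁
-- and p₃ = e₀ ⊕ e₁ ⊕ e₂; so the edges of a cycle are sent to vectors summing to zero.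
fanoMinusPoint : List (V 3)
fanoMinusPoint = (true ∷ false ∷ false ∷ []) ∷ (false ∷ true ∷ false ∷ []) ∷ (true ∷ true ∷ true ∷ [])
  ∷ (true ∷ true ∷ false ∷ []) ∷ (false ∷ true ∷ true ∷ []) ∷ (true ∷ false ∷ true ∷ []) ∷ []

affinePlane : List (V 3)
affinePlane = (true ∷ false ∷ false ∷ []) ∷ (true ∷ true ∷ false ∷ [])
  ∷ (true ∷ false ∷ true ∷ []) ∷ (true ∷ true ∷ true ∷ []) ∷ []

fanoMinusPoint-cycles : ∀ S → (¬ HasCycle S) ⇔ LinIndep (select fanoMinusPoint S)
fanoMinusPoint-cycles = ⇔-onAllSubsets (¬? ∘ hasCycle?) (linIndep? ∘ select fanoMinusPoint) tt

affinePlane-circuits : ∀ S → ∣ S ∣ ≤ 3 ⇔ LinIndep (select affinePlane S)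
affinePlane-circuits = ⇔-onAllSubsets (λ S → ∣ S ∣ ≤? 3) (linIndep? ∘ select affinePlane) tt

inM-head : ∀ {i n} {v : V n} → 1 ≤ i → InM i (true ∷ v)
inM-head 1≤i = zero , 1≤i , refl

inM-second : ∀ {i n a} {v : V n} → 2 ≤ i → InM i (a ∷ true ∷ v)
inM-second 2≤i = suc zero , 2≤i , refl

≅-byIdentity : ∀ {n} {I J : Subset n → Set} → (∀ S → J S ⇔ I S) →
  record { size = n ; Indep = I } ≅ record { size = n ; Indep = J }
≅-byIdentity {I = I} {J} J⇔I = id , bijective _≡_ , λ S →
  subst (λ T → J S ⇔ I T) (sym (tabulate∘lookup S)) (J⇔I S)

unique? : ∀ {n} (xs : List (V n)) → Dec (Unique xs)
unique? = Data.List.Relation.Unary.Unique.DecPropositional.unique? (Vec.≡-dec Bool._≟_)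

module Plane (k : ℕ) where
  open LinearEmbedding (plane k) (plane-⊕ k) (plane-injective k)

  affinePlane-complete : ∀ t → InM 1 (plane k t) → t ∈ affinePlane
  affinePlane-complete (true  ∷ false ∷ false ∷ []) _ = here refl
  affinePlane-complete (true  ∷ true  ∷ false ∷ []) _ = there (here refl)
  affinePlane-complete (true  ∷ false ∷ true  ∷ []) _ = there (there (here refl))
  affinePlane-complete (true  ∷ true  ∷ true  ∷ []) _ = there (there (there (here refl)))
  affinePlane-complete (false ∷ _ ∷ _ ∷ []) (zero  , _     , ())
  affinePlane-complete (false ∷ _ ∷ _ ∷ []) (suc _ , s≤s () , _)

  fanoMinusPoint-complete : ∀ {i} → i ≤ k → ∀ t → InM (2 + i) (plane k t) → t ∈ fanoMinusPoint
  fanoMinusPoint-complete _ (true  ∷ false ∷ false ∷ []) _ = here refl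
  fanoMinusPoint-complete _ (false ∷ true  ∷ false ∷ []) _ = there (here refl)
  fanoMinusPoint-complete _ (true  ∷ true  ∷ true  ∷ []) _ = there (there (here refl))
  fanoMinusPoint-complete _ (true  ∷ true  ∷ false ∷ []) _ = there (there (there (here refl)))
  fanoMinusPoint-complete _ (false ∷ true  ∷ true  ∷ []) _ = there (there (there (there (here refl))))
  fanoMinusPoint-complete _ (true  ∷ false ∷ true  ∷ []) _ = there (there (there (there (there (here refl)))))
  fanoMinusPoint-complete i≤k (false ∷ false ∷ _ ∷ []) (suc (suc j) , s≤s (s≤s j<i) , e∈) =
    ⊥-elim (<-irrefl (lookup-onlyLast k j e∈) (≤-trans j<i i≤k))

  affinePlane-isFlat : IsFlat 1 (map (plane k) affinePlane)
  affinePlane-isFlat = isFlat-map affinePlane (from-yes (unique? affinePlane))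
    (h ∷ h ∷ h ∷ h ∷ []) affinePlane-complete
    where
    h : ∀ {n} {v : V n} → InM 1 (true ∷ v)
    h = inM-head (s≤s z≤n)

  fanoMinusPoint-isFlat : ∀ {i} → i ≤ k → IsFlat (2 + i) (map (plane k) fanoMinusPoint)
  fanoMinusPoint-isFlat {i} i≤k = isFlat-map fanoMinusPoint (from-yes (unique? fanoMinusPoint))
    (h ∷ s ∷ h ∷ h ∷ s ∷ h ∷ []) (fanoMinusPoint-complete i≤k)
    where
    h : ∀ {n} {v : V n} → InM (2 + i) (true ∷ v)
    h = inM-head (s≤s z≤n)
    s : ∀ {n a} {v : V n} → InM (2 + i) (a ∷ true ∷ v)
    s = inM-second (s≤s (s≤s z≤n))

  affinePlane≅U34 : vecMatroid (map (plane k) affinePlane) ≅ U34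
  affinePlane≅U34 = ≅-byIdentity λ S →
    ⇔-sym (linIndep-select-map affinePlane S) ⇔-∘
      subst (λ T → ∣ S ∣ ≤ 3 ⇔ LinIndep (select affinePlane T))
            (sym (cast-is-id _ S)) (affinePlane-circuits S)

  fanoMinusPoint≅MK4 : vecMatroid (map (plane k) fanoMinusPoint) ≅ MK4
  fanoMinusPoint≅MK4 = ≅-byIdentity λ S →
    ⇔-sym (linIndep-select-map fanoMinusPoint S) ⇔-∘
      subst (λ T → (¬ HasCycle S) ⇔ LinIndep (select fanoMinusPoint T))
            (sym (cast-is-id _ S)) (fanoMinusPoint-cycles S)

lemma3p3 : (r i : ℕ) → 3 ≤ r → 1 ≤ i → i < r →
    Σ (List (V r)) λ F → IsFlat i F ×
      ((vecMatroid F ≅ MK4) ⊎ (vecMatroid F ≅ U34))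
lemma3p3 (suc (suc (suc k))) 1 _ _ _ =
  map (plane k) affinePlane , affinePlane-isFlat , inj₂ affinePlane≅U34
  where open Plane k
lemma3p3 (suc (suc (suc k))) (suc (suc i)) _ _ (s≤s (s≤s (s≤s i≤k))) =
  map (plane k) fanoMinusPoint , fanoMinusPoint-isFlat i≤k , inj₁ fanoMinusPoint≅MK4
  where open Plane k
lemma3p3 1 _ (s≤s ()) _ _
lemma3p3 2 _ (s≤s (s≤s ())) _ _
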